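{- For any positive integer $b$ and any integer $k\ge 2$ there is a set $\{n_1,\ldots,n_k\}$ of positive integers with $n_1<n_2<\cdots<n_k$ such that for all $1\le i<j\le k$, the number $\frac{n_j}{n_j-n_i}$ is an integer divisible by $b$. -}

module Defs where

{-# OPTIONS --safe #-}
-- If Q₁ < ⋯ < Q_k satisfy Q_j / (Q_j − Q_i) ≡ 1 (mod c) for all i < j, then for any common
-- multiple M of the products Q_i Q_j the complements n_i = M − M/Q_i satisfy
-- n_j / (n_j − n_i) = (Q_i / (Q_j − Q_i)) (Q_j − 1), a multiple of c.  Such chains grow one
-- term at a time: if P is a common multiple of the Q_i, then cP, cP + Q₁, …, cP + Q_k is
-- again one.  Taking c = 2b makes every Q_i at least 2, so every n_i is positive.
module Submission where

open import Defs
open import Data.Nat using (ℕ; _*_; _∸_; _<_; _≥_)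
open import Data.Nat.Divisibility using (_∣_)
open import Data.Fin using (Fin) renaming (_<_ to _<ᶠ_)
open import Data.Product using (Σ; ∃; _×_)
open import Relation.Binary.PropositionalEquality using (_≡_)

open import Data.Nat using (zero; suc; _+_; _≤_; z<s; s≤s; NonZero; >-nonZero; >-nonZero⁻¹)
open import Data.Nat.Properties
open import Data.Nat.Divisibility
  using ( divides; quotient; m∣n⇒n≡quotient*m; ∣-trans; ∣m∣n⇒∣m+n; m∣m*n; n∣m*n; ∣m⇒∣m*n
        ; *-pres-∣; *-monoʳ-∣; *-monoˡ-∣; 0∣⇒≡0)
open import Data.Nat.ListAction using (product)
open import Data.Nat.ListAction.Properties using (∈⇒∣product; product≢0)
open import Data.Nat.Solver using (module +-*-Solver)
open import Data.Fin using (zero; suc)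
open import Data.List using (tabulate)
open import Data.List.Membership.Propositional.Properties using (∈-tabulate⁺)
open import Data.List.Relation.Unary.All.Properties using (tabulate⁺)
open import Data.Vec.Functional using (_∷_)
open import Data.Product using (_,_; proj₁; proj₂)
open import Relation.Nullary using (contradiction)
open import Relation.Binary.PropositionalEquality
  using (refl; sym; trans; cong; cong₂; subst; subst₂; module ≡-Reasoning)

open +-*-Solver using (solve; _:=_; _:+_; _:*_; con)

∣-product-tabulate : ∀ {m} (f : Fin m → ℕ) i → f i ∣ product (tabulate f)
∣-product-tabulate f i = ∈⇒∣product (∈-tabulate⁺ i)

product-tabulate-pos : ∀ {m} (f : Fin m → ℕ) → (∀ i → 0 < f i) → 0 < product (tabulate f)
product-tabulate-pos f f-pos =
  >-nonZero⁻¹ _ {{product≢0 (tabulate⁺ (λ i → >-nonZero (f-pos i)))}}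

-- y / (y − x) is an integer ≡ 1 (mod c)
record RatioOneMod (c x y : ℕ) : Set where
  constructor ratioOneMod
  field
    gap       : ℕ
    y≡x+gap   : y ≡ x + gap
    c*gap∣x   : c * gap ∣ x

-- y / (y − x) is an integer ≡ 0 (mod b)
record RatioZeroMod (b x y : ℕ) : Set where
  constructor ratioZeroMod
  field
    gap       : ℕ
    y≡x+gap   : y ≡ x + gap
    b*gap∣y   : b * gap ∣ y

ratioOneMod-base : ∀ {c x P} → x ∣ P → RatioOneMod c (c * P) (c * P + x)
ratioOneMod-base {c} x∣P = ratioOneMod _ refl (*-monoʳ-∣ c x∣P)

ratioOneMod-shift : ∀ {c x y P} → x ∣ P → RatioOneMod c x y →
                    RatioOneMod c (c * P + x) (c * P + y)
ratioOneMod-shift {c} {x} {P = P} x∣P (ratioOneMod e refl ce∣x) =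
  ratioOneMod e (sym (+-assoc (c * P) x e))
    (∣m∣n⇒∣m+n (∣-trans (∣-trans ce∣x x∣P) (n∣m*n c)) ce∣x)

OneModChain : ℕ → ℕ → Set
OneModChain c m = Σ (Fin m → ℕ) λ Q →
  (∀ i → c ≤ Q i) × (∀ i j → i <ᶠ j → RatioOneMod c (Q i) (Q j))

oneModChain-extend : ∀ {c m} → 0 < c → OneModChain c m → OneModChain c (suc m)
oneModChain-extend {c} {m} 0<c (Q , c≤Q , Q-ratio) = Q′ , c≤Q′ , Q′-ratio
  where
  P A : ℕ
  P = product (tabulate Q)
  A = c * P

  Q′ : Fin (suc m) → ℕ
  Q′ = A ∷ λ i → A + Q i

  c≤Q′ : ∀ i → c ≤ Q′ i
  c≤Q′ zero    = m≤m*n c P {{>-nonZero P-pos}}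
    where
    P-pos : 0 < P
    P-pos = product-tabulate-pos Q (λ i → ≤-trans 0<c (c≤Q i))
  c≤Q′ (suc i) = ≤-trans (c≤Q i) (m≤n+m (Q i) A)

  Q′-ratio : ∀ i j → i <ᶠ j → RatioOneMod c (Q′ i) (Q′ j)
  Q′-ratio zero    (suc j) _         = ratioOneMod-base (∣-product-tabulate Q j)
  Q′-ratio (suc i) (suc j) (s≤s i<j) = ratioOneMod-shift (∣-product-tabulate Q i) (Q-ratio i j i<j)

oneModChain : ∀ {c} → 0 < c → ∀ m → OneModChain c m
oneModChain 0<c zero    = (λ ()) , (λ ()) , λ ()
oneModChain 0<c (suc m) = oneModChain-extend 0<c (oneModChain 0<c m)

quotient-unique : ∀ {x M} D (x∣M : x ∣ M) .{{_ : NonZero x}} → M ≡ D * x → quotient x∣M ≡ D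
quotient-unique {x} D x∣M M≡Dx =
  *-cancelʳ-≡ (quotient x∣M) D x (trans (sym (m∣n⇒n≡quotient*m x∣M)) M≡Dx)

complement : ∀ {x M} → x ∣ M → ℕ
complement {M = M} x∣M = M ∸ quotient x∣M

complement≡ : ∀ {x M} (x∣M : x ∣ M) → complement x∣M ≡ quotient x∣M * (x ∸ 1)
complement≡ {x} {M} x∣M = begin
  M ∸ D          ≡⟨ cong₂ _∸_ (m∣n⇒n≡quotient*m x∣M) (sym (*-identityʳ D)) ⟩
  D * x ∸ D * 1  ≡⟨ *-distribˡ-∸ D x 1 ⟨
  D * (x ∸ 1)    ∎
  where
  open ≡-Reasoning
  D : ℕ
  D = quotient x∣M

complement-pos : ∀ {x M} → 0 < M → 1 < x → (x∣M : x ∣ M) → 0 < complement x∣M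
complement-pos {x} {M} 0<M 1<x x∣M = m<n⇒0<n∸m (subst (D <_) (sym M≡Dx) D<Dx)
  where
  D : ℕ
  D = quotient x∣M
  M≡Dx : M ≡ D * x
  M≡Dx = m∣n⇒n≡quotient*m x∣M
  D<Dx : D < D * x
  D<Dx = m<m*n D x {{m*n≢0⇒m≢0 D {{>-nonZero (subst (0 <_) M≡Dx 0<M)}}}} 1<x

-- With M = L x y, these are the complements M − M/x and M − M/y.
complement-ratioZeroMod : ∀ {c x y} L → 0 < x → RatioOneMod c x y →
                          RatioZeroMod c (L * y * (x ∸ 1)) (L * x * (y ∸ 1))
complement-ratioZeroMod {c} {suc p} L _ (ratioOneMod e refl ce∣x) =
  ratioZeroMod (L * e) gap c*gap∣
  where
  gap : L * suc p * (p + e) ≡ L * (suc p + e) * p + L * e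
  gap = solve 3 (λ L p e → L :* (con 1 :+ p) :* (p :+ e)
                          := L :* (con 1 :+ p :+ e) :* p :+ L :* e) refl L p e

  c*gap∣ : c * (L * e) ∣ L * suc p * (p + e)
  c*gap∣ = ∣m⇒∣m*n (p + e) (subst (_∣ L * suc p) L*ce≡c*Le (*-monoʳ-∣ L ce∣x))
    where
    L*ce≡c*Le : L * (c * e) ≡ c * (L * e)
    L*ce≡c*Le = solve 3 (λ L c e → L :* (c :* e) := c :* (L :* e)) refl L c e

complement-ratio : ∀ {c x y M} → 0 < x → RatioOneMod c x y → x * y ∣ M →
                   (x∣M : x ∣ M) (y∣M : y ∣ M) → RatioZeroMod c (complement x∣M) (complement y∣M)
complement-ratio {c} {x} {y} 0<x r@(ratioOneMod e y≡x+e _) (divides L M≡L*xy) x∣M y∣M =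
  subst₂ (RatioZeroMod c) (sym complement-x) (sym complement-y) (complement-ratioZeroMod L 0<x r)
  where
  0<y : 0 < y
  0<y = ≤-trans 0<x (subst (x ≤_) (sym y≡x+e) (m≤m+n x e))

  complement-x : complement x∣M ≡ L * y * (x ∸ 1)
  complement-x = trans (complement≡ x∣M) (cong (_* (x ∸ 1))
    (quotient-unique (L * y) x∣M {{>-nonZero 0<x}}
      (trans M≡L*xy (trans (cong (L *_) (*-comm x y)) (sym (*-assoc L y x))))))

  complement-y : complement y∣M ≡ L * x * (y ∸ 1)
  complement-y = trans (complement≡ y∣M) (cong (_* (y ∸ 1))
    (quotient-unique (L * x) y∣M {{>-nonZero 0<y}} (trans M≡L*xy (sym (*-assoc L x y)))))

ZeroModFamily : ℕ → ℕ → Set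
ZeroModFamily b k = Σ (Fin k → ℕ) λ n →
  (∀ i → 0 < n i) × (∀ i j → i <ᶠ j → RatioZeroMod b (n i) (n j))

ratioZeroMod-∣ : ∀ {a b x y} → a ∣ b → RatioZeroMod b x y → RatioZeroMod a x y
ratioZeroMod-∣ a∣b (ratioZeroMod d y≡x+d bd∣y) = ratioZeroMod d y≡x+d (∣-trans (*-monoˡ-∣ d a∣b) bd∣y)

ratioZeroMod⇒quotient : ∀ {b x y} → 0 < y → RatioZeroMod b x y →
                        x < y × ∃ λ q → y ≡ q * (y ∸ x) × b ∣ q
ratioZeroMod⇒quotient {b} {x} 0<y (ratioZeroMod zero refl b0∣y) =
  contradiction (0∣⇒≡0 (subst (_∣ x + 0) (*-zeroʳ b) b0∣y)) (>⇒≢ 0<y)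
ratioZeroMod⇒quotient {b} {x} _ (ratioZeroMod d@(suc _) refl (divides q y≡qbd)) =
  m<m+n x z<s , q * b , y≡qb[y-x] , n∣m*n q
  where
  open ≡-Reasoning
  y≡qb[y-x] : x + d ≡ q * b * (x + d ∸ x)
  y≡qb[y-x] = begin
    x + d              ≡⟨ y≡qbd ⟩
    q * (b * d)        ≡⟨ *-assoc q b d ⟨
    q * b * d          ≡⟨ cong (q * b *_) (m+n∸m≡n x d) ⟨
    q * b * (x + d ∸ x) ∎

oneModChain⇒zeroModFamily : ∀ {c k} → 1 < c → OneModChain c k → ZeroModFamily c k
oneModChain⇒zeroModFamily {c} {k} 1<c (Q , c≤Q , Q-ratio) = n , n-pos , n-ratio
  where
  1<Q : ∀ i → 1 < Q i
  1<Q i = ≤-trans 1<c (c≤Q i)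
  Q-pos : ∀ i → 0 < Q i
  Q-pos i = <-trans z<s (1<Q i)
  P M : ℕ
  P = product (tabulate Q)
  M = P * P
  Q∣M : ∀ i → Q i ∣ M
  Q∣M i = ∣m⇒∣m*n P (∣-product-tabulate Q i)

  n : Fin k → ℕ
  n i = complement (Q∣M i)

  n-pos : ∀ i → 0 < n i
  n-pos i = complement-pos (*-mono-≤ P-pos P-pos) (1<Q i) (Q∣M i)
    where
    P-pos : 0 < P
    P-pos = product-tabulate-pos Q Q-pos

  n-ratio : ∀ i j → i <ᶠ j → RatioZeroMod c (n i) (n j)
  n-ratio i j i<j = complement-ratio (Q-pos i) (Q-ratio i j i<j)
    (*-pres-∣ (∣-product-tabulate Q i) (∣-product-tabulate Q j)) (Q∣M i) (Q∣M j)

lemma1 : (b : ℕ) → 0 < b → (k : ℕ) → k ≥ 2 →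
    Σ (Fin k → ℕ) λ n →
      ((i : Fin k) → 0 < n i) ×
      ((i j : Fin k) → i <ᶠ j → n i < n j) ×
      ((i j : Fin k) → i <ᶠ j →
        ∃ λ q → n j ≡ q * (n j ∸ n i) × b ∣ q)
-- The construction needs no lower bound on k.
lemma1 b 0<b k _ =
  n , n-pos , (λ i j i<j → proj₁ (n-quotient i j i<j)) , (λ i j i<j → proj₂ (n-quotient i j i<j))
  where
  1<2b : 1 < b * 2
  1<2b = *-monoˡ-≤ 2 0<b
  family : ZeroModFamily (b * 2) k
  family = oneModChain⇒zeroModFamily 1<2b (oneModChain (<-trans z<s 1<2b) k)
  n : Fin k → ℕ
  n = proj₁ family
  n-pos : ∀ i → 0 < n i
  n-pos = proj₁ (proj₂ family)

  n-quotient : ∀ i j → i <ᶠ j → n i < n j × ∃ λ q → n j ≡ q * (n j ∸ n i) × b ∣ q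
  n-quotient i j i<j =
    ratioZeroMod⇒quotient (n-pos j) (ratioZeroMod-∣ (m∣m*n 2) (proj₂ (proj₂ family) i j i<j))
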